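{- Let $k\ge1$ and let $D$ be a digraph with $\vec{\chi}(D)\ge k+1$. Let $(X_1,X_2)$ be a partition of $V(D)$ into nonempty sets such that there are at most $k$ arcs from $X_1$ to $X_2$, and such that $D[X_1]$ and $D[X_2]$ are both $k$-dicolourable; let $\phi_1$ be a $k$-dicolouring of $D[X_1]$ and $\phi_2$ a $k$-dicolouring of $D[X_2]$. Then one of the following holds: (a) there is a unique colour $i$ such that some vertex of $\phi_1^{ -1}(i)$ has an out-neighbour in $X_2$ (i.e. all vertices of $X_1$ with out-neighbours in $X_2$ lie in $\phi_1^{ -1}(i)$), and in this case for every $1\le j\le k$ there is exactly one arc from $\phi_1^{ -1}(i)$ to $\phi_2^{ -1}(j)$ and at least one arc from $\phi_2^{ -1}(j)$ to $\phi_1^{ -1}(i)$; (b) there is a unique colour $j$ such that some vertex of $\phi_2^{ -1}(j)$ has an in-neighbour in $X_1$, and in this case for every $1\le i\le k$ there is exactly one arc from $\phi_1^{ -1}(i)$ to $\phi_2^{ -1}(j)$ and at least one arc from $\phi_2^{ -1}(j)$ to $\phi_1^{ -1}(i)$. In particular there are exactly $k$ arcs from $X_1$ to $X_2$. Consequently, if there are also at most $k$ arcs from $X_2$ to $X_1$, then there are exactly $k$ arcs in each direction between $X_1$ and $X_2$, and for any $k$-dicolourings of $D[X_1]$ and $D[X_2]$, on one side all arcs between $X_1$ and $X_2$ are incident to a single colour class, while on the other side every colour class is incident to exactly one arc in each direction between $X_1$ and $X_2$.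
   Context: Digraphs are finite, without loops or parallel arcs. A $k$-dicolouring of $D$ is a map $V(D)\to\{1,\dots,k\}$ whose colour classes induce acyclic subdigraphs; $\vec{\chi}(D)$ is the least such $k$. $D[X]$ denotes the subdigraph induced by $X$. -}

module Defs where

open import Data.Nat using (ℕ; zero; suc; _+_; _≤_; _≥_)
open import Data.Fin using (Fin; zero; suc; inject₁; fromℕ) renaming (_≟_ to _≟ᶠ_)
open import Data.Bool using (Bool; true; false; _∧_; not; if_then_else_)
open import Data.List using (List; allFin; map)
open import Data.Nat.ListAction using (sum)
open import Data.Product using (Σ; ∃; _×_; _,_)
open import Data.Sum using (_⊎_)
open import Relation.Nullary using (¬_)
open import Relation.Nullary.Decidable using (⌊_⌋)
open import Relation.Binary.PropositionalEquality using (_≡_)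
open import Function.Definitions using (Injective)

-- A finite digraph without loops or parallel arcs, on vertex set Fin n.
-- adj u v ≡ true  means there is an arc u → v.
record Digraph : Set where
  field
    n        : ℕ
    adj      : Fin n → Fin n → Bool
    loopless : ∀ v → adj v v ≡ false
open Digraph public

Vertex : Digraph → Set
Vertex D = Fin (n D)

VSet : Digraph → Set
VSet D = Vertex D → Bool

Arc : (D : Digraph) → Vertex D → Vertex D → Set
Arc D u v = adj D u v ≡ true

-- A directed cycle of length suc m ≥ 2: distinct vertices c 0, …, c m with
-- arcs c i → c (i+1) and c m → c 0.
record Cycle (D : Digraph) : Set where
  field
    m     : ℕ
    m≥1   : m ≥ 1
    c     : Fin (suc m) → Vertex D
    inj   : Injective _≡_ _≡_ c
    step  : (i : Fin m) → Arc D (c (inject₁ i)) (c (suc i))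
    close : Arc D (c (fromℕ m)) (c zero)

Acyclic : (D : Digraph) → VSet D → Set
Acyclic D S = ¬ (Σ (Cycle D) λ C → ∀ i → S (Cycle.c C i) ≡ true)

ColourClass : (D : Digraph) {k : ℕ} → VSet D → (Vertex D → Fin k) → Fin k → VSet D
ColourClass D X φ i v = X v ∧ ⌊ φ v ≟ᶠ i ⌋

-- φ (only its values on X matter) is a k-dicolouring of D[X]:
-- every colour class induces an acyclic subdigraph.
IsDicolouring : (D : Digraph) (k : ℕ) → VSet D → (Vertex D → Fin k) → Set
IsDicolouring D k X φ = ∀ i → Acyclic D (ColourClass D X φ i)

full : (D : Digraph) → VSet D
full D _ = true

complement : (D : Digraph) → VSet D → VSet D
complement D X v = not (X v)

Dicolourable : Digraph → ℕ → Set
Dicolourable D k = Σ (Vertex D → Fin k) λ φ → IsDicolouring D k (full D) φ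

arcs : (D : Digraph) → VSet D → VSet D → ℕ
arcs D A B =
  sum (map (λ u → sum (map (λ v → if A u ∧ B v ∧ adj D u v then 1 else 0)
                             (allFin (n D))))
           (allFin (n D)))

SomeArc : (D : Digraph) → VSet D → VSet D → Set
SomeArc D A B = ∃ λ u → ∃ λ v → A u ≡ true × B v ≡ true × Arc D u v

module _ (D : Digraph) {k : ℕ} (X₁ : VSet D)
         (φ₁ φ₂ : Vertex D → Fin k) where
  private
    X₂ = complement D X₁
    C₁ = ColourClass D X₁ φ₁
    C₂ = ColourClass D X₂ φ₂

  CaseA : Set
  CaseA = ∃ λ i → SomeArc D (C₁ i) X₂
                × (∀ i' → SomeArc D (C₁ i') X₂ → i' ≡ i)
                × (∀ j → arcs D (C₁ i) (C₂ j) ≡ 1 × arcs D (C₂ j) (C₁ i) ≥ 1)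

  CaseB : Set
  CaseB = ∃ λ j → SomeArc D X₁ (C₂ j)
                × (∀ j' → SomeArc D X₁ (C₂ j') → j' ≡ j)
                × (∀ i → arcs D (C₁ i) (C₂ j) ≡ 1 × arcs D (C₂ j) (C₁ i) ≥ 1)

  SingleSide : (X : VSet D) (φ : Vertex D → Fin k) → Set
  SingleSide X φ = ∃ λ i → ∀ u v →
      (X u ≡ true → complement D X v ≡ true → Arc D u v ⊎ Arc D v u →
       φ u ≡ i)

  SpreadSide : (X : VSet D) (φ : Vertex D → Fin k) → Set
  SpreadSide X φ = ∀ i →
      arcs D (ColourClass D X φ i) (complement D X) ≡ 1
    × arcs D (complement D X) (ColourClass D X φ i) ≡ 1

  Consequence : Set
  Consequence = arcs D X₂ X₁ ≡ k
    × ((SingleSide X₁ φ₁ × SpreadSide X₂ φ₂) ⊎ (SpreadSide X₁ φ₁ × SingleSide X₂ φ₂))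

-- Call colours i of X₁ and j of X₂ linked if there are arcs in both directions between
-- the colour classes φ₁⁻¹(i) and φ₂⁻¹(j).  If a permutation π of the colours avoided
-- every linked pair (i, π i), recolouring X₂ by π⁻¹ ∘ φ₂ and gluing it to φ₁ would give
-- a k-dicolouring of D: a monochromatic cycle lies in one side, or crosses the cut in
-- both directions inside a linked pair.  So the linked relation meets every permutation,
-- and a König-type count shows that such a k × k relation has at least k pairs, with
-- exactly k only if it contains a full row or a full column.  Each linked pair carries
-- a forward arc and there are at most k of them, so a full row i leaves exactly one arc
-- from class i to each class of X₂ and none from the other classes (case (a)), and a
-- full column gives case (b).  The bound on backward arcs yields the consequence in the
-- same way.

module Submission where

open import Defs
open import Algebra.Bundles using (CommutativeMonoid)
open import Data.Bool using (Bool; true; false; _∧_; not; if_then_else_)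
open import Data.Bool.Properties
  using (not-involutive; not-¬; ¬-not; ∧-assoc; ∧-commutativeMonoid) renaming (_≟_ to _≟ᵇ_)
open import Data.Empty using (⊥-elim)
open import Data.Fin using (Fin; zero; suc; punchIn; punchOut; inject₁; fromℕ)
import Data.Fin as Fin
open import Data.Fin.Permutation
  using (Permutation′; _⟨$⟩ʳ_; _⟨$⟩ˡ_; inverseʳ; insert) renaming (id to idₚ)
open import Data.Fin.Properties
  using (_≟_; ≤fromℕ; punchInᵢ≢i; punchIn-punchOut; any?; all?; ¬∀⟶∃¬)
open import Data.List using (tabulate; map; allFin)
open import Data.List.Properties using (map-tabulate)
open import Data.Nat using (ℕ; zero; suc; _+_; _≤_; _≥_; _≤?_; z≤n; s≤s)
import Data.Nat.ListAction as List
open import Data.Nat.Properties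
  using (≤-trans; ≤-antisym; <⇒≱; n≤0⇒n≡0; m<n⇒n≢0; m≤m+n; m≤n+m; m+n≤o⇒m≤o; +-assoc;
         +-identityʳ; +-mono-≤; +-monoʳ-≤; +-cancelˡ-≤; +-cancelʳ-≤; +-0-commutativeMonoid;
         module ≤-Reasoning)
open import Data.Product using (∃; ∃₂; _×_; _,_; proj₁; proj₂; map₁)
open import Data.Sum using (_⊎_; inj₁; inj₂)
open import Function using (_∘_; flip)
open import Relation.Binary using (Decidable)
open import Relation.Binary.PropositionalEquality hiding ([_])
open import Relation.Nullary using (¬_; Dec; yes; no; contradiction)
open import Relation.Nullary.Decidable using (⌊_⌋; _×-dec_; dec-true; dec-false; isYes≗does)

open import Algebra.Properties.CommutativeMonoid.Sum +-0-commutativeMonoid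
  using (sum-syntax; sum-cong-≗; sum-remove; ∑-comm; ∑-distrib-+)
open import Algebra.Properties.CommutativeSemigroup
  (CommutativeMonoid.commutativeSemigroup ∧-commutativeMonoid) using (x∙yz≈y∙xz)

-- Finite sums of natural numbers

[_] : Bool → ℕ
[ b ] = if b then 1 else 0

List-sum-allFin : ∀ {n} (f : Fin n → ℕ) → List.sum (map f (allFin n)) ≡ ∑[ i < n ] f i
List-sum-allFin {n} f = trans (cong List.sum (map-tabulate (λ i → i) f)) (sum-tabulate f)
  where
  sum-tabulate : ∀ {n} (f : Fin n → ℕ) → List.sum (tabulate f) ≡ ∑[ i < n ] f i
  sum-tabulate {zero} f = refl
  sum-tabulate {suc n} f = cong (f zero +_) (sum-tabulate (f ∘ suc))

∑-ones : ∀ n → ∑[ i < n ] 1 ≡ n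
∑-ones zero = refl
∑-ones (suc n) = cong suc (∑-ones n)

∑-mono-≤ : ∀ {n} {f g : Fin n → ℕ} → (∀ i → f i ≤ g i) → ∑[ i < n ] f i ≤ ∑[ i < n ] g i
∑-mono-≤ {zero} f≤g = z≤n
∑-mono-≤ {suc n} f≤g = +-mono-≤ (f≤g zero) (∑-mono-≤ (f≤g ∘ suc))

≤-∑ : ∀ {n} (f : Fin n → ℕ) i → f i ≤ ∑[ j < n ] f j
≤-∑ {suc n} f i = subst (f i ≤_) (sym (sum-remove f)) (m≤m+n (f i) _)

∑≡0⇒≡0 : ∀ {n} (f : Fin n → ℕ) → ∑[ i < n ] f i ≡ 0 → ∀ i → f i ≡ 0
∑≡0⇒≡0 f ∑≡0 i = n≤0⇒n≡0 (subst (f i ≤_) ∑≡0 (≤-∑ f i))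

∑-zero : ∀ {n} {f : Fin n → ℕ} → (∀ i → f i ≡ 0) → ∑[ i < n ] f i ≡ 0
∑-zero {zero} f≡0 = refl
∑-zero {suc n} f≡0 = cong₂ _+_ (f≡0 zero) (∑-zero (f≡0 ∘ suc))

∑-positive : ∀ {n} (f : Fin n → ℕ) → 1 ≤ ∑[ i < n ] f i → ∃ λ i → 1 ≤ f i
∑-positive {suc n} f 1≤∑ with f zero in eq
... | suc _ = zero , subst (1 ≤_) (sym eq) (s≤s z≤n)
... | zero with ∑-positive (f ∘ suc) 1≤∑
...   | i , 1≤fi = suc i , 1≤fi

∑-≤-pointwise⇒≡ : ∀ {n} (f g : Fin n → ℕ) → (∀ i → g i ≤ f i) →
                  ∑[ i < n ] f i ≤ ∑[ i < n ] g i → ∀ i → f i ≡ g i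
∑-≤-pointwise⇒≡ {suc n} f g g≤f ∑f≤∑g i = ≤-antisym fi≤gi (g≤f i)
  where
  fi≤gi : f i ≤ g i
  fi≤gi = +-cancelʳ-≤ _ (f i) (g i) (begin
    f i + ∑[ j < n ] f (punchIn i j) ≡⟨ sum-remove f ⟨
    ∑[ j < suc n ] f j               ≤⟨ ∑f≤∑g ⟩
    ∑[ j < suc n ] g j               ≡⟨ sum-remove g ⟩
    g i + ∑[ j < n ] g (punchIn i j) ≤⟨ +-monoʳ-≤ (g i) (∑-mono-≤ (g≤f ∘ punchIn i)) ⟩
    g i + ∑[ j < n ] f (punchIn i j) ∎)
    where open ≤-Reasoning

-- Relations on Fin m meeting every permutation

⌊⌋-true : ∀ {A : Set} (a? : Dec A) → A → ⌊ a? ⌋ ≡ true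
⌊⌋-true a? a = trans (isYes≗does a?) (dec-true a? a)

⌊⌋-false : ∀ {A : Set} (a? : Dec A) → ¬ A → ⌊ a? ⌋ ≡ false
⌊⌋-false a? ¬a = trans (isYes≗does a?) (dec-false a? ¬a)

[⌊⌋]-≤ : ∀ {A : Set} {n} (a? : Dec A) → (A → 1 ≤ n) → [ ⌊ a? ⌋ ] ≤ n
[⌊⌋]-≤ (yes a) 1≤n = 1≤n a
[⌊⌋]-≤ (no _) _ = z≤n

module _ {m : ℕ} {R : Fin m → Fin m → Set} (R? : Decidable R) where

  rowCount : Fin m → ℕ
  rowCount x = ∑[ y < m ] [ ⌊ R? x y ⌋ ]

  colCount : Fin m → ℕ
  colCount y = ∑[ x < m ] [ ⌊ R? x y ⌋ ]

  count : ℕ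
  count = ∑[ x < m ] rowCount x

  1≤rowCount : ∀ {x y} → R x y → 1 ≤ rowCount x
  1≤rowCount {x} {y} r =
    subst (_≤ rowCount x) (cong [_] (⌊⌋-true (R? x y) r)) (≤-∑ (λ y → [ ⌊ R? x y ⌋ ]) y)

  1≤colCount : ∀ {x y} → R x y → 1 ≤ colCount y
  1≤colCount {x} {y} r =
    subst (_≤ colCount y) (cong [_] (⌊⌋-true (R? x y) r)) (≤-∑ (λ x → [ ⌊ R? x y ⌋ ]) x)

minor : ∀ {m} {R : Fin (suc m) → Fin (suc m) → Set} → Decidable R → (r c : Fin (suc m)) →
        Decidable (λ x y → R (punchIn r x) (punchIn c y))
minor R? r c x y = R? (punchIn r x) (punchIn c y)

MeetsEveryPermutation : ∀ {m} → (Fin m → Fin m → Set) → Set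
MeetsEveryPermutation {m} R = (π : Permutation′ m) → ∃ λ x → R x (π ⟨$⟩ʳ x)

minor-meets : ∀ {m} {R : Fin (suc m) → Fin (suc m) → Set} {r c} → ¬ R r c →
              MeetsEveryPermutation R →
              MeetsEveryPermutation (λ x y → R (punchIn r x) (punchIn c y))
-- insert r c π computes to c at r, and to punchIn c (π ⟨$⟩ʳ x) at punchIn r x.
minor-meets {R = R} {r} {c} ¬Rrc meets π with meets (insert r c π)
... | x , Rxσx with r ≟ x
...   | yes refl = contradiction Rxσx ¬Rrc
...   | no r≢x = punchOut r≢x ,
  subst (λ z → R z (punchIn c (π ⟨$⟩ʳ punchOut r≢x))) (sym (punchIn-punchOut r≢x)) Rxσx

count-remove : ∀ {m} {R : Fin (suc m) → Fin (suc m) → Set} (R? : Decidable R) {r c} → ¬ R r c →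
               count R? ≡ rowCount R? r + (colCount R? c + count (minor R? r c))
count-remove {m} R? {r} {c} ¬Rrc = begin
  count R?
    ≡⟨ sum-remove {i = r} (rowCount R?) ⟩
  rowCount R? r + ∑[ x < m ] rowCount R? (punchIn r x)
    ≡⟨ cong (rowCount R? r +_)
            (sum-cong-≗ (λ x → sum-remove {i = c} (λ y → [ ⌊ R? (punchIn r x) y ⌋ ]))) ⟩
  rowCount R? r + ∑[ x < m ] ([ ⌊ R? (punchIn r x) c ⌋ ] + rowCount (minor R? r c) x)
    ≡⟨ cong (rowCount R? r +_)
            (∑-distrib-+ (λ x → [ ⌊ R? (punchIn r x) c ⌋ ]) (rowCount (minor R? r c))) ⟩
  rowCount R? r + (∑[ x < m ] [ ⌊ R? (punchIn r x) c ⌋ ] + count (minor R? r c))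
    ≡⟨ cong (λ s → rowCount R? r + (s + count (minor R? r c))) colCount-c ⟨
  rowCount R? r + (colCount R? c + count (minor R? r c)) ∎
  where
  open ≡-Reasoning
  colCount-c : colCount R? c ≡ ∑[ x < m ] [ ⌊ R? (punchIn r x) c ⌋ ]
  colCount-c = trans (sum-remove {i = r} (λ x → [ ⌊ R? x c ⌋ ]))
    (cong (λ e → [ e ] + ∑[ x < m ] [ ⌊ R? (punchIn r x) c ⌋ ]) (⌊⌋-false (R? r c) ¬Rrc))

meets⇒≤count : ∀ {m} {R : Fin m → Fin m → Set} (R? : Decidable R) →
               MeetsEveryPermutation R → m ≤ count R?
meets⇒≤count {zero} R? _ = z≤n
meets⇒≤count {suc n} {R} R? meets with meets idₚ
... | a , Raa with all? (R? a)
...   | yes fullRow = begin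
  suc n                             ≡⟨ ∑-ones (suc n) ⟨
  ∑[ y < suc n ] 1                  ≡⟨ sum-cong-≗ (λ y → cong [_] (⌊⌋-true (R? a y) (fullRow y))) ⟨
  rowCount R? a                     ≤⟨ ≤-∑ (rowCount R?) a ⟩
  count R?                          ∎
  where open ≤-Reasoning
...   | no ¬fullRow with ¬∀⟶∃¬ _ _ (R? a) ¬fullRow
...     | c , ¬Rac = begin
  suc n
    ≤⟨ +-mono-≤ (1≤rowCount R? Raa)
                (≤-trans (meets⇒≤count (minor R? a c) (minor-meets {R = R} ¬Rac meets)) (m≤n+m _ _)) ⟩
  rowCount R? a + (colCount R? c + count (minor R? a c)) ≡⟨ count-remove R? ¬Rac ⟨
  count R?                                               ∎
  where open ≤-Reasoning

row+col≤1 : ∀ {n} {R : Fin (suc n) → Fin (suc n) → Set} (R? : Decidable R) →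
            MeetsEveryPermutation R → count R? ≤ suc n →
            ∀ {x y} → ¬ R x y → rowCount R? x + colCount R? y ≤ 1
row+col≤1 {n} {R} R? meets count≤ {x} {y} ¬Rxy = +-cancelʳ-≤ n _ 1 (begin
  rowCount R? x + colCount R? y + n
    ≤⟨ +-monoʳ-≤ _ (meets⇒≤count (minor R? x y) (minor-meets {R = R} ¬Rxy meets)) ⟩
  rowCount R? x + colCount R? y + count (minor R? x y)   ≡⟨ +-assoc (rowCount R? x) (colCount R? y) _ ⟩
  rowCount R? x + (colCount R? y + count (minor R? x y)) ≡⟨ count-remove R? ¬Rxy ⟨
  count R?                                               ≤⟨ count≤ ⟩
  1 + n                                                  ∎)
  where open ≤-Reasoning

meets⇒fullLine : ∀ {m} {R : Fin m → Fin m → Set} (R? : Decidable R) →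
                 MeetsEveryPermutation R → count R? ≤ m →
                 (∃ λ x → ∀ y → R x y) ⊎ (∃ λ y → ∀ x → R x y)
meets⇒fullLine {zero} R? meets _ with meets idₚ
... | () , _
meets⇒fullLine {suc n} {R} R? meets count≤
  with any? (λ x → all? (R? x)) | any? (λ y → all? (λ x → R? x y))
... | yes fullRow | _ = inj₁ fullRow
... | no _ | yes fullCol = inj₂ fullCol
-- Otherwise every row has a false entry, so by row+col≤1 every row holds at most one
-- true entry, and the row through a false entry of a nonempty column holds none.
... | no ¬fullRow | no ¬fullCol with meets idₚ
...   | a , Raa with ¬∀⟶∃¬ _ _ (λ x → R? x a) (λ fullCol → ¬fullCol (a , fullCol))
...     | r , ¬Rra = contradiction (meets⇒≤count R? meets) (<⇒≱ (s≤s count≤n))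
  where
  rowCount-r≡0 : rowCount R? r ≡ 0
  rowCount-r≡0 = n≤0⇒n≡0 (+-cancelʳ-≤ 1 _ 0
    (≤-trans (+-monoʳ-≤ _ (1≤colCount R? Raa)) (row+col≤1 R? meets count≤ ¬Rra)))
  rowCount≤1 : ∀ x → rowCount R? x ≤ 1
  rowCount≤1 x with ¬∀⟶∃¬ _ _ (R? x) (λ fullRow → ¬fullRow (x , fullRow))
  ... | y , ¬Rxy = ≤-trans (m≤m+n _ _) (row+col≤1 R? meets count≤ ¬Rxy)
  count≤n : count R? ≤ n
  count≤n = begin
    count R?                                             ≡⟨ sum-remove {i = r} (rowCount R?) ⟩
    rowCount R? r + ∑[ x < n ] rowCount R? (punchIn r x)
      ≡⟨ cong (_+ ∑[ x < n ] rowCount R? (punchIn r x)) rowCount-r≡0 ⟩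
    ∑[ x < n ] rowCount R? (punchIn r x)                 ≤⟨ ∑-mono-≤ (rowCount≤1 ∘ punchIn r) ⟩
    ∑[ x < n ] 1                                         ≡⟨ ∑-ones n ⟩
    n                                                    ∎
    where open ≤-Reasoning

-- Matrices concentrated on one row

RowOfOnes : ∀ {k} → (Fin k → Fin k → ℕ) → Fin k → Set
RowOfOnes f a = (∀ y → f a y ≡ 1) × (∀ x y → x ≢ a → f x y ≡ 0)

positiveRow⇒rowOfOnes : ∀ {k} (f : Fin k → Fin k → ℕ) a → (∀ y → 1 ≤ f a y) →
                        ∑[ x < k ] ∑[ y < k ] f x y ≤ k → RowOfOnes f a
positiveRow⇒rowOfOnes {suc n} f a 1≤fa ∑∑≤k = ones , zeros
  where
  R : Fin (suc n) → ℕ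
  R x = ∑[ y < suc n ] f x y
  k≤Ra : suc n ≤ R a
  k≤Ra = subst (_≤ R a) (∑-ones (suc n)) (∑-mono-≤ 1≤fa)
  Ra+rest≤k : R a + ∑[ x < n ] R (punchIn a x) ≤ suc n
  Ra+rest≤k = subst (_≤ suc n) (sum-remove {i = a} R) ∑∑≤k
  ones : ∀ y → f a y ≡ 1
  ones = ∑-≤-pointwise⇒≡ (f a) (λ _ → 1) 1≤fa
           (subst (R a ≤_) (sym (∑-ones (suc n))) (m+n≤o⇒m≤o (R a) Ra+rest≤k))
  rest≡0 : ∑[ x < n ] R (punchIn a x) ≡ 0
  rest≡0 = n≤0⇒n≡0 (+-cancelˡ-≤ (R a) _ 0
             (≤-trans Ra+rest≤k (subst (suc n ≤_) (sym (+-identityʳ (R a))) k≤Ra)))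
  zeros : ∀ x y → x ≢ a → f x y ≡ 0
  zeros x y x≢a = subst (λ z → f z y ≡ 0) (punchIn-punchOut a≢x)
    (∑≡0⇒≡0 (f (punchIn a (punchOut a≢x))) (∑≡0⇒≡0 (R ∘ punchIn a) rest≡0 (punchOut a≢x)) y)
    where a≢x = x≢a ∘ sym

rowOfOnes-colSum : ∀ {k} {f : Fin k → Fin k → ℕ} {a} → RowOfOnes f a →
                   ∀ y → ∑[ x < k ] f x y ≡ 1
rowOfOnes-colSum {suc n} {f} {a} (ones , zeros) y = trans (sum-remove {i = a} (λ x → f x y))
  (cong₂ _+_ (ones y) (∑-zero (λ x → zeros (punchIn a x) y (punchInᵢ≢i a x))))

rowOfOnes-total : ∀ {k} {f : Fin k → Fin k → ℕ} {a} → RowOfOnes f a →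
                  ∑[ x < k ] ∑[ y < k ] f x y ≡ k
rowOfOnes-total {k} {f} ones = trans (∑-comm f) (trans (sum-cong-≗ (rowOfOnes-colSum ones)) (∑-ones k))

rowOfOnes-support : ∀ {k} {f : Fin k → Fin k → ℕ} {a} → RowOfOnes f a →
                    ∀ {x y} → 1 ≤ f x y → x ≡ a
rowOfOnes-support {a = a} (_ , zeros) {x} {y} 1≤fxy with x ≟ a
... | yes x≡a = x≡a
... | no x≢a = contradiction (zeros x y x≢a) (m<n⇒n≢0 1≤fxy)

-- Directed cycles crossing a vertex set

consecutive-switch : ∀ {m} (f : Fin (suc m) → Bool) (p : Bool) {x y : Fin (suc m)} → x Fin.≤ y →
          f x ≡ p → f y ≡ not p → ∃ λ (i : Fin m) → f (inject₁ i) ≡ p × f (suc i) ≡ not p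
consecutive-switch f p {zero} {zero} _ f0≡p f0≡¬p = contradiction (trans (sym f0≡p) f0≡¬p) (not-¬ refl)
consecutive-switch {suc m} f p {zero} {suc y} _ f0≡p fy≡¬p with f (suc zero) ≟ᵇ p
... | no f1≢p = zero , f0≡p , ¬-not f1≢p
... | yes f1≡p with consecutive-switch (f ∘ suc) p {zero} {y} z≤n f1≡p fy≡¬p
...   | i , fi≡p , fi+1≡¬p = suc i , fi≡p , fi+1≡¬p
consecutive-switch {suc m} f p {suc x} {suc y} (s≤s x≤y) fx≡p fy≡¬p
  with consecutive-switch (f ∘ suc) p x≤y fx≡p fy≡¬p
... | i , fi≡p , fi+1≡¬p = suc i , fi≡p , fi+1≡¬p

module _ {D : Digraph} (C : Cycle D) where
  open Cycle C

  CrossingArc : VSet D → Bool → Set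
  CrossingArc S p = ∃₂ λ s t → Arc D (c s) (c t) × S (c s) ≡ p × S (c t) ≡ not p

  step-crossing : ∀ {S p} → (∃ λ i → S (c (inject₁ i)) ≡ p × S (c (suc i)) ≡ not p) →
                  CrossingArc S p
  step-crossing (i , Si≡p , Si+1≡¬p) = inject₁ i , suc i , step i , Si≡p , Si+1≡¬p

  cycle-crosses : (S : VSet D) (p : Bool) {x y : Fin (suc m)} →
                  S (c x) ≡ p → S (c y) ≡ not p → CrossingArc S p
  cycle-crosses S p {x} {y} Sx≡p Sy≡¬p with S (c zero) ≟ᵇ p | S (c (fromℕ m)) ≟ᵇ p
  ... | yes S0≡p | _ = step-crossing {S} (consecutive-switch (S ∘ c) p z≤n S0≡p Sy≡¬p)
  ... | no S0≢p | yes Slast≡p = fromℕ m , zero , close , Slast≡p , ¬-not S0≢p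
  ... | no _ | no Slast≢p =
    step-crossing {S} (consecutive-switch (S ∘ c) p (≤fromℕ x) Sx≡p (¬-not Slast≢p))

-- Counting arcs between vertex sets

∑-select : ∀ {k} (a : Fin k) (b : Bool) → ∑[ i < k ] [ ⌊ a ≟ i ⌋ ∧ b ] ≡ [ b ]
∑-select {suc k} a b = begin
  ∑[ i < suc k ] [ ⌊ a ≟ i ⌋ ∧ b ]
    ≡⟨ sum-remove {i = a} (λ i → [ ⌊ a ≟ i ⌋ ∧ b ]) ⟩
  [ ⌊ a ≟ a ⌋ ∧ b ] + ∑[ i < k ] [ ⌊ a ≟ punchIn a i ⌋ ∧ b ]
    ≡⟨ cong₂ _+_ (cong (λ d → [ d ∧ b ]) (⌊⌋-true (a ≟ a) refl))
                 (∑-zero (λ i → cong (λ d → [ d ∧ b ])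
                                     (⌊⌋-false (a ≟ punchIn a i) (punchInᵢ≢i a i ∘ sym)))) ⟩
  [ b ] + 0                                                   ≡⟨ +-identityʳ [ b ] ⟩
  [ b ]                                                       ∎
  where open ≡-Reasoning

module _ (D : Digraph) where

  arcs-∑ : (A B : VSet D) → arcs D A B ≡ ∑[ u < n D ] ∑[ v < n D ] [ A u ∧ B v ∧ adj D u v ]
  arcs-∑ A B = trans (List-sum-allFin (λ u → List.sum (map (entry u) (allFin (n D)))))
                     (sum-cong-≗ (λ u → List-sum-allFin (entry u)))
    where
    entry : Vertex D → Vertex D → ℕ
    entry u v = [ A u ∧ B v ∧ adj D u v ]

  arcs-cong : ∀ {A A′ B B′ : VSet D} → (∀ u → A u ≡ A′ u) → (∀ v → B v ≡ B′ v) →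
              arcs D A B ≡ arcs D A′ B′
  arcs-cong {A} {A′} {B} {B′} A≗A′ B≗B′ = begin
    arcs D A B                                                 ≡⟨ arcs-∑ A B ⟩
    ∑[ u < n D ] ∑[ v < n D ] [ A u ∧ B v ∧ adj D u v ]
      ≡⟨ sum-cong-≗ (λ u → sum-cong-≗ (λ v →
           cong₂ (λ a b → [ a ∧ b ∧ adj D u v ]) (A≗A′ u) (B≗B′ v))) ⟩
    ∑[ u < n D ] ∑[ v < n D ] [ A′ u ∧ B′ v ∧ adj D u v ]     ≡⟨ arcs-∑ A′ B′ ⟨
    arcs D A′ B′                                               ∎
    where open ≡-Reasoning

  SomeArc⇒1≤arcs : ∀ (A B : VSet D) → SomeArc D A B → 1 ≤ arcs D A B
  SomeArc⇒1≤arcs A B (u , v , Au , Bv , u→v) = begin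
    1                                                   ≡⟨ entry≡1 ⟨
    [ A u ∧ B v ∧ adj D u v ]                           ≤⟨ ≤-∑ _ v ⟩
    ∑[ v < n D ] [ A u ∧ B v ∧ adj D u v ]              ≤⟨ ≤-∑ _ u ⟩
    ∑[ u < n D ] ∑[ v < n D ] [ A u ∧ B v ∧ adj D u v ] ≡⟨ arcs-∑ A B ⟨
    arcs D A B                                          ∎
    where
    open ≤-Reasoning
    entry≡1 : [ A u ∧ B v ∧ adj D u v ] ≡ 1
    entry≡1 rewrite Au | Bv | u→v = refl

  1≤arcs⇒SomeArc : ∀ {A B : VSet D} → 1 ≤ arcs D A B → SomeArc D A B
  1≤arcs⇒SomeArc {A} {B} 1≤arcs
    with ∑-positive _ (subst (1 ≤_) (arcs-∑ A B) 1≤arcs)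
  ... | u , 1≤row with ∑-positive _ 1≤row
  ...   | v , 1≤entry = u , v , entry-true (A u) (B v) (adj D u v) 1≤entry
    where
    entry-true : ∀ a b t → 1 ≤ [ a ∧ b ∧ t ] → a ≡ true × b ≡ true × t ≡ true
    entry-true true true true _ = refl , refl , refl

  SomeArc-mono : ∀ {A A′ B B′ : VSet D} → (∀ u → A u ≡ true → A′ u ≡ true) →
                 (∀ v → B v ≡ true → B′ v ≡ true) → SomeArc D A B → SomeArc D A′ B′
  SomeArc-mono A⊆A′ B⊆B′ (u , v , Au , Bv , u→v) = u , v , A⊆A′ u Au , B⊆B′ v Bv , u→v

  Acyclic-mono : ∀ {S S′ : VSet D} → (∀ v → S′ v ≡ true → S v ≡ true) →
                 Acyclic D S → Acyclic D S′
  Acyclic-mono S′⊆S acyclic (C , inS′) = acyclic (C , λ t → S′⊆S _ (inS′ t))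

  module _ {k : ℕ} (X : VSet D) (φ : Vertex D → Fin k) where

    class⁺ : ∀ {i v} → X v ≡ true → φ v ≡ i → ColourClass D X φ i v ≡ true
    class⁺ {i} {v} Xv φv≡i = cong₂ _∧_ Xv (⌊⌋-true (φ v ≟ i) φv≡i)

    class⁻ : ∀ {i v} → ColourClass D X φ i v ≡ true → X v ≡ true × φ v ≡ i
    class⁻ {i} {v} inClass with X v | φ v ≟ i
    class⁻ refl | true | yes φv≡i = refl , φv≡i
    class⁻ ()   | true | no _
    class⁻ ()   | false | _

  ∑-arcs : ∀ {k} (A B : Fin k → VSet D) →
           ∑[ i < k ] arcs D (A i) (B i) ≡
           ∑[ u < n D ] ∑[ v < n D ] ∑[ i < k ] [ A i u ∧ B i v ∧ adj D u v ]
  ∑-arcs A B = begin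
    ∑[ i < _ ] arcs D (A i) (B i)
      ≡⟨ sum-cong-≗ (λ i → arcs-∑ (A i) (B i)) ⟩
    ∑[ i < _ ] ∑[ u < n D ] ∑[ v < n D ] [ A i u ∧ B i v ∧ adj D u v ]
      ≡⟨ ∑-comm (λ i u → ∑[ v < n D ] [ A i u ∧ B i v ∧ adj D u v ]) ⟩
    ∑[ u < n D ] ∑[ i < _ ] ∑[ v < n D ] [ A i u ∧ B i v ∧ adj D u v ]
      ≡⟨ sum-cong-≗ (λ u → ∑-comm (λ i v → [ A i u ∧ B i v ∧ adj D u v ])) ⟩
    ∑[ u < n D ] ∑[ v < n D ] ∑[ i < _ ] [ A i u ∧ B i v ∧ adj D u v ] ∎
    where open ≡-Reasoning

  arcs-splitʳ : ∀ {k} (A X : VSet D) (φ : Vertex D → Fin k) →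
                arcs D A X ≡ ∑[ i < k ] arcs D A (ColourClass D X φ i)
  arcs-splitʳ A X φ = sym (begin
    ∑[ i < _ ] arcs D A (ColourClass D X φ i)
      ≡⟨ ∑-arcs (λ _ → A) (ColourClass D X φ) ⟩
    ∑[ u < n D ] ∑[ v < n D ] ∑[ i < _ ] [ A u ∧ (X v ∧ ⌊ φ v ≟ i ⌋) ∧ adj D u v ]
      ≡⟨ sum-cong-≗ (λ u → sum-cong-≗ (λ v → trans
           (sum-cong-≗ (λ i → cong [_] (rearrange (A u) (X v) ⌊ φ v ≟ i ⌋ (adj D u v))))
           (∑-select (φ v) _))) ⟩
    ∑[ u < n D ] ∑[ v < n D ] [ A u ∧ X v ∧ adj D u v ] ≡⟨ arcs-∑ A X ⟨
    arcs D A X                                          ∎)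
    where
    open ≡-Reasoning
    rearrange : ∀ a x d t → a ∧ (x ∧ d) ∧ t ≡ d ∧ a ∧ x ∧ t
    rearrange a x d t =
      trans (cong (a ∧_) (trans (∧-assoc x d t) (x∙yz≈y∙xz x d t))) (x∙yz≈y∙xz a d (x ∧ t))

  arcs-splitˡ : ∀ {k} (X B : VSet D) (φ : Vertex D → Fin k) →
                arcs D X B ≡ ∑[ i < k ] arcs D (ColourClass D X φ i) B
  arcs-splitˡ X B φ = sym (begin
    ∑[ i < _ ] arcs D (ColourClass D X φ i) B
      ≡⟨ ∑-arcs (ColourClass D X φ) (λ _ → B) ⟩
    ∑[ u < n D ] ∑[ v < n D ] ∑[ i < _ ] [ (X u ∧ ⌊ φ u ≟ i ⌋) ∧ B v ∧ adj D u v ]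
      ≡⟨ sum-cong-≗ (λ u → sum-cong-≗ (λ v → trans
           (sum-cong-≗ (λ i → cong [_] (rearrange (X u) ⌊ φ u ≟ i ⌋ (B v ∧ adj D u v))))
           (∑-select (φ u) _))) ⟩
    ∑[ u < n D ] ∑[ v < n D ] [ X u ∧ B v ∧ adj D u v ] ≡⟨ arcs-∑ X B ⟨
    arcs D X B                                          ∎)
    where
    open ≡-Reasoning
    rearrange : ∀ x d r → (x ∧ d) ∧ r ≡ d ∧ x ∧ r
    rearrange x d r = trans (∧-assoc x d r) (x∙yz≈y∙xz x d r)

  module _ {k : ℕ} (X : VSet D) (φ : Vertex D → Fin k) (π : Permutation′ k) where

    permuted-class : ∀ {i} v → ColourClass D X ((π ⟨$⟩ˡ_) ∘ φ) i v ≡ true →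
                     ColourClass D X φ (π ⟨$⟩ʳ i) v ≡ true
    permuted-class v member with class⁻ X ((π ⟨$⟩ˡ_) ∘ φ) member
    ... | Xv , π⁻¹φv≡i = class⁺ X φ Xv (trans (sym (inverseʳ π)) (cong (π ⟨$⟩ʳ_) π⁻¹φv≡i))

    IsDicolouring-permute : IsDicolouring D k X φ → IsDicolouring D k X ((π ⟨$⟩ˡ_) ∘ φ)
    IsDicolouring-permute dic i = Acyclic-mono permuted-class (dic (π ⟨$⟩ʳ i))

-- Gluing dicolourings of the two sides

module _ (D : Digraph) {k : ℕ} (X₁ : VSet D) (φ₁ φ₂ : Vertex D → Fin k) where
  private
    X₂ = complement D X₁
    C₁ C₂ : Fin k → VSet D
    C₁ = ColourClass D X₁ φ₁
    C₂ = ColourClass D X₂ φ₂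

  glue : Vertex D → Fin k
  glue u = if X₁ u then φ₁ u else φ₂ u

  glue-class₁ : ∀ {u i} → X₁ u ≡ true → glue u ≡ i → C₁ i u ≡ true
  glue-class₁ {u} X₁u glue≡i =
    class⁺ D X₁ φ₁ X₁u (trans (sym (cong (if_then φ₁ u else φ₂ u) X₁u)) glue≡i)

  glue-class₂ : ∀ {u i} → X₁ u ≡ false → glue u ≡ i → C₂ i u ≡ true
  glue-class₂ {u} X₁u glue≡i =
    class⁺ D X₂ φ₂ (cong not X₁u) (trans (sym (cong (if_then φ₁ u else φ₂ u) X₁u)) glue≡i)

  glued-cycle-links : IsDicolouring D k X₁ φ₁ → IsDicolouring D k X₂ φ₂ →
                      (C : Cycle D) (i : Fin k) → (∀ t → glue (Cycle.c C t) ≡ i) →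
                      SomeArc D (C₁ i) (C₂ i) × SomeArc D (C₂ i) (C₁ i)
  glued-cycle-links dic₁ dic₂ C i coloured
    with any? (λ t → X₁ (Cycle.c C t) ≟ᵇ false) | any? (λ t → X₁ (Cycle.c C t) ≟ᵇ true)
  ... | no ∄out | _ = ⊥-elim (dic₁ i (C , λ t → glue-class₁ (¬-not (∄out ∘ (t ,_))) (coloured t)))
  ... | yes _ | no ∄in = ⊥-elim (dic₂ i (C , λ t → glue-class₂ (¬-not (∄in ∘ (t ,_))) (coloured t)))
  ... | yes (_ , outside) | yes (_ , inside) =
    exit (cycle-crosses C X₁ true inside outside) , entry (cycle-crosses C X₁ false outside inside)
    where
    open Cycle C
    exit : CrossingArc C X₁ true → SomeArc D (C₁ i) (C₂ i)
    exit (s , t , s→t , X₁s , X₁t) =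
      c s , c t , glue-class₁ X₁s (coloured s) , glue-class₂ X₁t (coloured t) , s→t
    entry : CrossingArc C X₁ false → SomeArc D (C₂ i) (C₁ i)
    entry (s , t , s→t , X₁s , X₁t) =
      c s , c t , glue-class₂ X₁s (coloured s) , glue-class₁ X₁t (coloured t) , s→t

  glue-dicolouring : IsDicolouring D k X₁ φ₁ → IsDicolouring D k X₂ φ₂ →
                     (∀ i → ¬ (SomeArc D (C₁ i) (C₂ i) × SomeArc D (C₂ i) (C₁ i))) →
                     IsDicolouring D k (full D) glue
  glue-dicolouring dic₁ dic₂ unlinked i (C , monochromatic) =
    unlinked i (glued-cycle-links dic₁ dic₂ C i
                  (λ t → proj₂ (class⁻ D (full D) glue (monochromatic t))))

-- Linked colour classes across the cut

module _ (D : Digraph) {k : ℕ} (X₁ : VSet D) (φ₁ φ₂ : Vertex D → Fin k) where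
  private
    X₂ = complement D X₁
    C₁ C₂ : Fin k → VSet D
    C₁ = ColourClass D X₁ φ₁
    C₂ = ColourClass D X₂ φ₂

  fwd bwd : Fin k → Fin k → ℕ
  fwd i j = arcs D (C₁ i) (C₂ j)
  bwd i j = arcs D (C₂ j) (C₁ i)

  Linked : Fin k → Fin k → Set
  Linked i j = 1 ≤ fwd i j × 1 ≤ bwd i j

  linked? : Decidable Linked
  linked? i j = (1 ≤? fwd i j) ×-dec (1 ≤? bwd i j)

  arcs₁₂-by-colours : arcs D X₁ X₂ ≡ ∑[ i < k ] ∑[ j < k ] fwd i j
  arcs₁₂-by-colours =
    trans (arcs-splitˡ D X₁ X₂ φ₁) (sum-cong-≗ (λ i → arcs-splitʳ D (C₁ i) X₂ φ₂))

  arcs₂₁-by-colours : arcs D X₂ X₁ ≡ ∑[ i < k ] ∑[ j < k ] bwd i j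
  arcs₂₁-by-colours = begin
    arcs D X₂ X₁                     ≡⟨ arcs-splitˡ D X₂ X₁ φ₂ ⟩
    ∑[ j < k ] arcs D (C₂ j) X₁      ≡⟨ sum-cong-≗ (λ j → arcs-splitʳ D (C₂ j) X₁ φ₁) ⟩
    ∑[ j < k ] ∑[ i < k ] bwd i j    ≡⟨ ∑-comm (flip bwd) ⟩
    ∑[ i < k ] ∑[ j < k ] bwd i j    ∎
    where open ≡-Reasoning

  count-linked≤arcs₁₂ : count linked? ≤ arcs D X₁ X₂
  count-linked≤arcs₁₂ = subst (count linked? ≤_) (sym arcs₁₂-by-colours)
    (∑-mono-≤ (λ i → ∑-mono-≤ (λ j → [⌊⌋]-≤ (linked? i j) proj₁)))

  linked-meets : ¬ Dicolourable D k → IsDicolouring D k X₁ φ₁ → IsDicolouring D k X₂ φ₂ →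
                 MeetsEveryPermutation Linked
  linked-meets ¬dic dic₁ dic₂ π with any? (λ i → linked? i (π ⟨$⟩ʳ i))
  ... | yes meets = meets
  ... | no ¬meets =
    ⊥-elim (¬dic (glue D X₁ φ₁ φ₂′ , glue-dicolouring D X₁ φ₁ φ₂′ dic₁ dic₂′ unlinked))
    where
    φ₂′ : Vertex D → Fin k
    φ₂′ = (π ⟨$⟩ˡ_) ∘ φ₂
    dic₂′ : IsDicolouring D k X₂ φ₂′
    dic₂′ = IsDicolouring-permute D X₂ φ₂ π dic₂
    toC₂ : ∀ {i} v → ColourClass D X₂ φ₂′ i v ≡ true → C₂ (π ⟨$⟩ʳ i) v ≡ true
    toC₂ = permuted-class D X₂ φ₂ π
    unlinked : ∀ i → ¬ (SomeArc D (C₁ i) (ColourClass D X₂ φ₂′ i) ×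
                        SomeArc D (ColourClass D X₂ φ₂′ i) (C₁ i))
    unlinked i (exit , entry) = ¬meets (i ,
      SomeArc⇒1≤arcs D (C₁ i) (C₂ (π ⟨$⟩ʳ i)) (SomeArc-mono D (λ _ in₁ → in₁) toC₂ exit) ,
      SomeArc⇒1≤arcs D (C₂ (π ⟨$⟩ʳ i)) (C₁ i) (SomeArc-mono D toC₂ (λ _ in₁ → in₁) entry))

  fwd-arc : ∀ {u v} → X₁ u ≡ true → X₂ v ≡ true → Arc D u v → 1 ≤ fwd (φ₁ u) (φ₂ v)
  fwd-arc {u} {v} X₁u X₂v u→v =
    SomeArc⇒1≤arcs D (C₁ (φ₁ u)) (C₂ (φ₂ v))
      (u , v , class⁺ D X₁ φ₁ X₁u refl , class⁺ D X₂ φ₂ X₂v refl , u→v)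

  bwd-arc : ∀ {u v} → X₁ u ≡ true → X₂ v ≡ true → Arc D v u → 1 ≤ bwd (φ₁ u) (φ₂ v)
  bwd-arc {u} {v} X₁u X₂v v→u =
    SomeArc⇒1≤arcs D (C₂ (φ₂ v)) (C₁ (φ₁ u))
      (v , u , class⁺ D X₂ φ₂ X₂v refl , class⁺ D X₁ φ₁ X₁u refl , v→u)

  X₁≗¬X₂ : ∀ v → complement D X₂ v ≡ X₁ v
  X₁≗¬X₂ v = not-involutive (X₁ v)

  linkedRow⇒caseA : ∀ i → (∀ j → Linked i j) → (∃ λ v → X₂ v ≡ true) → arcs D X₁ X₂ ≤ k →
                    CaseA D X₁ φ₁ φ₂ × arcs D X₁ X₂ ≡ k ×
                    (arcs D X₂ X₁ ≤ k → Consequence D X₁ φ₁ φ₂)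
  linkedRow⇒caseA i linked (v₂ , X₂v₂) fwd≤k =
    (i , exit , unique , λ j → proj₁ fwdOnes j , proj₂ (linked j)) ,
    trans arcs₁₂-by-colours (rowOfOnes-total fwdOnes) ,
    consequence
    where
    fwdOnes : RowOfOnes fwd i
    fwdOnes = positiveRow⇒rowOfOnes fwd i (proj₁ ∘ linked) (subst (_≤ k) arcs₁₂-by-colours fwd≤k)
    exit : SomeArc D (C₁ i) X₂
    exit = SomeArc-mono D (λ _ in₁ → in₁) (λ _ in₂ → proj₁ (class⁻ D X₂ φ₂ in₂))
             (1≤arcs⇒SomeArc D (proj₁ (linked (φ₂ v₂))))
    unique : ∀ i′ → SomeArc D (C₁ i′) X₂ → i′ ≡ i
    unique i′ (u , v , inC₁ , X₂v , u→v) = rowOfOnes-support fwdOnes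
      (SomeArc⇒1≤arcs D (C₁ i′) (C₂ (φ₂ v)) (u , v , inC₁ , class⁺ D X₂ φ₂ X₂v refl , u→v))
    consequence : arcs D X₂ X₁ ≤ k → Consequence D X₁ φ₁ φ₂
    consequence bwd≤k = trans arcs₂₁-by-colours (rowOfOnes-total bwdOnes) , inj₁ (single , spread)
      where
      bwdOnes : RowOfOnes bwd i
      bwdOnes = positiveRow⇒rowOfOnes bwd i (proj₂ ∘ linked) (subst (_≤ k) arcs₂₁-by-colours bwd≤k)
      single : SingleSide D X₁ φ₁ φ₂ X₁ φ₁
      single = i , λ where
        u v X₁u X₂v (inj₁ u→v) → rowOfOnes-support fwdOnes (fwd-arc X₁u X₂v u→v)
        u v X₁u X₂v (inj₂ v→u) → rowOfOnes-support bwdOnes (bwd-arc X₁u X₂v v→u)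
      spread : SpreadSide D X₁ φ₁ φ₂ X₂ φ₂
      spread j =
        trans (arcs-cong D {C₂ j} {C₂ j} (λ _ → refl) X₁≗¬X₂)
              (trans (arcs-splitʳ D (C₂ j) X₁ φ₁) (rowOfOnes-colSum bwdOnes j)) ,
        trans (arcs-cong D {B = C₂ j} {B′ = C₂ j} X₁≗¬X₂ (λ _ → refl))
              (trans (arcs-splitˡ D X₁ (C₂ j) φ₁) (rowOfOnes-colSum fwdOnes j))

  linkedColumn⇒caseB : ∀ j → (∀ i → Linked i j) → (∃ λ v → X₁ v ≡ true) → arcs D X₁ X₂ ≤ k →
                       CaseB D X₁ φ₁ φ₂ × arcs D X₁ X₂ ≡ k ×
                       (arcs D X₂ X₁ ≤ k → Consequence D X₁ φ₁ φ₂)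
  linkedColumn⇒caseB j linked (v₁ , X₁v₁) fwd≤k =
    (j , entry , unique , λ i → proj₁ fwdOnes i , proj₂ (linked i)) ,
    trans fwd-transposed (rowOfOnes-total fwdOnes) ,
    consequence
    where
    fwd-transposed : arcs D X₁ X₂ ≡ ∑[ j < k ] ∑[ i < k ] fwd i j
    fwd-transposed = trans arcs₁₂-by-colours (∑-comm fwd)
    fwdOnes : RowOfOnes (flip fwd) j
    fwdOnes = positiveRow⇒rowOfOnes (flip fwd) j (proj₁ ∘ linked) (subst (_≤ k) fwd-transposed fwd≤k)
    entry : SomeArc D X₁ (C₂ j)
    entry = SomeArc-mono D (λ _ in₁ → proj₁ (class⁻ D X₁ φ₁ in₁)) (λ _ in₂ → in₂)
              (1≤arcs⇒SomeArc D (proj₁ (linked (φ₁ v₁))))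
    unique : ∀ j′ → SomeArc D X₁ (C₂ j′) → j′ ≡ j
    unique j′ (u , v , X₁u , inC₂ , u→v) = rowOfOnes-support fwdOnes
      (SomeArc⇒1≤arcs D (C₁ (φ₁ u)) (C₂ j′) (u , v , class⁺ D X₁ φ₁ X₁u refl , inC₂ , u→v))
    consequence : arcs D X₂ X₁ ≤ k → Consequence D X₁ φ₁ φ₂
    consequence bwd≤k = trans bwd-transposed (rowOfOnes-total bwdOnes) , inj₂ (spread , single)
      where
      bwd-transposed : arcs D X₂ X₁ ≡ ∑[ j < k ] ∑[ i < k ] bwd i j
      bwd-transposed = trans arcs₂₁-by-colours (∑-comm bwd)
      bwdOnes : RowOfOnes (flip bwd) j
      bwdOnes = positiveRow⇒rowOfOnes (flip bwd) j (proj₂ ∘ linked) (subst (_≤ k) bwd-transposed bwd≤k)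
      spread : SpreadSide D X₁ φ₁ φ₂ X₁ φ₁
      spread i = trans (arcs-splitʳ D (C₁ i) X₂ φ₂) (rowOfOnes-colSum fwdOnes i) ,
                 trans (arcs-splitˡ D X₂ (C₁ i) φ₂) (rowOfOnes-colSum bwdOnes i)
      X₁v : ∀ {v} → complement D X₂ v ≡ true → X₁ v ≡ true
      X₁v {v} ¬X₂v = trans (sym (X₁≗¬X₂ v)) ¬X₂v
      single : SingleSide D X₁ φ₁ φ₂ X₂ φ₂
      single = j , λ where
        u v X₂u ¬X₂v (inj₁ u→v) → rowOfOnes-support bwdOnes (bwd-arc (X₁v ¬X₂v) X₂u u→v)
        u v X₂u ¬X₂v (inj₂ v→u) → rowOfOnes-support fwdOnes (fwd-arc (X₁v ¬X₂v) X₂u v→u)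

lemma3p3 : (k : ℕ) → k ≥ 1 → (D : Digraph) → ¬ Dicolourable D k →
    (X₁ : VSet D) → (∃ λ v → X₁ v ≡ true) → (∃ λ v → X₁ v ≡ false) →
    arcs D X₁ (complement D X₁) ≤ k →
    (φ₁ φ₂ : Vertex D → Fin k) →
    IsDicolouring D k X₁ φ₁ → IsDicolouring D k (complement D X₁) φ₂ →
    (CaseA D X₁ φ₁ φ₂ ⊎ CaseB D X₁ φ₁ φ₂)
    × arcs D X₁ (complement D X₁) ≡ k
    × (arcs D (complement D X₁) X₁ ≤ k → Consequence D X₁ φ₁ φ₂)
lemma3p3 k _ D ¬dic X₁ X₁-nonempty (v₂ , X₁v₂) fwd≤k φ₁ φ₂ dic₁ dic₂
  with meets⇒fullLine (linked? D X₁ φ₁ φ₂) (linked-meets D X₁ φ₁ φ₂ ¬dic dic₁ dic₂)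
                      (≤-trans (count-linked≤arcs₁₂ D X₁ φ₁ φ₂) fwd≤k)
... | inj₁ (i , linkedRow) =
  map₁ inj₁ (linkedRow⇒caseA D X₁ φ₁ φ₂ i linkedRow (v₂ , cong not X₁v₂) fwd≤k)
... | inj₂ (j , linkedColumn) =
  map₁ inj₂ (linkedColumn⇒caseB D X₁ φ₁ φ₂ j linkedColumn X₁-nonempty fwd≤k)
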